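{- Let $H=(V,E)$ be a 2-colorable hypergraph with at least one edge. Then $\operatorname{ch}(H)\le \lceil L(H)\rceil+1$, where \[ L(H)=\max_{\emptyset\neq E'\subset E}\frac{|E'|}{\left|\bigcup_{e\in E'}e\right|}. \]
   Context: A hypergraph is a pair $H=(V,E)$ with $V$ finite and $E\subset 2^V$. A coloring is proper if every edge contains two vertices of different colors; $H$ is 2-colorable if it has a proper coloring with 2 colors. $H$ is $k$-choosable if for every assignment of lists $L(v)$ of colors with $|L(v)|=k$ for all $v\in V$ there is a proper coloring assigning to each $v$ a color from $L(v)$. The list chromatic number $\operatorname{ch}(H)$ is the minimum $k$ such that $H$ is $k$-choosable. -}

module Defs where

open import Data.Nat using (ℕ; _≤_; _*_; suc)
open import Data.Fin using (Fin)
open import Data.Fin.Subset using (Subset; _∈_; ⋃; ∣_∣; Nonempty)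
open import Data.Vec using (lookup)
open import Data.List using (List; map; filterᵇ; allFin)
open import Data.Product using (Σ; ∃; _×_; proj₁)
open import Function.Definitions using (Injective)
open import Relation.Binary.PropositionalEquality using (_≡_; _≢_)

-- A hypergraph on vertex set V = Fin n with m edges, given as an injective
-- family of edges (so E is a genuine set of subsets of V, |E| = m).
record Hypergraph (n m : ℕ) : Set where
  field
    edge    : Fin m → Subset n
    edge-inj : Injective _≡_ _≡_ edge
open Hypergraph public

Proper : ∀ {n m} {C : Set} → Hypergraph n m → (Fin n → C) → Set
Proper H c = ∀ e → ∃ λ u → ∃ λ v → u ∈ edge H e × v ∈ edge H e × c u ≢ c v

TwoColorable : ∀ {n m} → Hypergraph n m → Set
TwoColorable H = Σ (Fin _ → Fin 2) (Proper H)

ColorList : ℕ → Set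
ColorList k = Σ (Fin k → ℕ) (Injective _≡_ _≡_)

_∈L_ : ∀ {k} → ℕ → ColorList k → Set
x ∈L L = ∃ λ i → proj₁ L i ≡ x

Choosable : ∀ {n m} → Hypergraph n m → ℕ → Set
Choosable {n} H k = (Lst : Fin n → ColorList k) →
  ∃ λ (c : Fin n → ℕ) → (∀ v → c v ∈L Lst v) × Proper H c

ChAtMost : ∀ {n m} → Hypergraph n m → ℕ → Set
ChAtMost H t = ∃ λ k → k ≤ t × Choosable H k

unionOf : ∀ {n m} → Hypergraph n m → Subset m → Subset n
unionOf {m = m} H E' = ⋃ (map (edge H) (filterᵇ (lookup E') (allFin m)))

-- k is an upper bound for L(H): |E'| / |⋃E'| ≤ k for all nonempty E' ⊆ E
-- (written without division as |E'| ≤ k * |⋃E'|).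
LBound : ∀ {n m} → Hypergraph n m → ℕ → Set
LBound H k = ∀ E' → Nonempty E' → ∣ E' ∣ ≤ k * ∣ unionOf H E' ∣

IsCeilL : ∀ {n m} → Hypergraph n m → ℕ → Set
IsCeilL H k = LBound H k × (∀ j → LBound H j → k ≤ j)

{-# OPTIONS --safe #-}
module Submission where

-- The bound |E′| ≤ k·|⋃E′| is Hall's condition for choosing in every edge e a
-- representative r e ∈ e such that each vertex represents at most k edges. A proper 2-colouring
-- gives in every edge e a vertex w e coloured differently from r e; orienting e as the arc
-- r e → w e yields a bipartite digraph in which every outdegree is at most k. Bipartite digraphs
-- are kernel-perfect, so by the kernel method (Bondy–Boppana–Siegel, Galvin) they can be
-- coloured from any lists longer than the outdegrees with the two ends of every arc coloured
-- differently; then every edge e is bichromatic, witnessed by r e and w e.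

open import Data.Nat.Properties
  using ( ≤-refl; ≤-trans; ≤-reflexive; ≤-<-trans; ≰⇒>; n≤0⇒n≡0; m<n+m; m≤n+m∸n; m+[n∸m]≡n
        ; +-identityʳ; *-identityʳ; *-zeroʳ; +-mono-≤; +-monoˡ-≤; +-monoʳ-≤; +-mono-<-≤; +-mono-≤-<
        ; +-cancelʳ-≤; *-monoʳ-≤; +-*-semiring; module ≤-Reasoning)
open import Algebra.Properties.Semiring.Sum +-*-semiring
  using (sum; sum-cong-≗; sum-replicate-zero; ∑-distrib-+; *-distribˡ-sum)
open import Data.Bool using (Bool; true; false; _∧_; _∨_; not; if_then_else_)
import Data.Bool as Bool
import Data.Bool.Properties as Bool
open import Data.Empty using (⊥; ⊥-elim)
open import Data.Fin using (Fin; zero; suc; _≟_)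
open import Data.Fin.Properties using (any?)
open import Data.Fin.Subset using (Subset; ⋃; ∣_∣)
import Data.Fin.Subset as S
open import Data.Fin.Subset.Properties using (anySubset?)
import Data.Fin.Subset.Properties as S
open import Data.List using (List; []; _∷_; map; filterᵇ; allFin)
open import Data.List.Membership.Propositional using () renaming (_∈_ to _∈ₗ_)
open import Data.List.Membership.Propositional.Properties using (∈-map⁻; ∈-filter⁻)
open import Data.List.Relation.Unary.Any using (here; there)
open import Data.Nat using (ℕ; zero; suc; _+_; _*_; _∸_; _≤_; _<_; _≥_; _≤?_; _<?_; z≤n; s≤s; z<s; s≤s⁻¹)
import Data.Nat as ℕ
open import Data.Nat.Induction using (<-wellFounded)
open import Data.Product using (∃; _×_; _,_; proj₁; proj₂)
open import Data.Sum using (_⊎_; inj₁; inj₂)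
open import Data.Vec using ([]; _∷_; lookup; tabulate)
open import Data.Vec.Properties using (lookup∘tabulate; []=⇒lookup; lookup⇒[]=)
open import Function using (_∘_; Equivalence)
open import Function.Definitions using (Injective)
open import Induction.WellFounded using (Acc; acc)
open import Relation.Binary.PropositionalEquality
open import Relation.Nullary using (Dec; yes; no; does; ¬_)
open import Relation.Nullary.Decidable using (T?; _×-dec_; ¬?; dec-true)

open import Defs

-- Finite sets as Boolean characteristic functions

variable
  m n : ℕ

does⇒ : {A : Set} (a? : Dec A) → does a? ≡ true → A
does⇒ (yes a) _ = a

Subsetᵇ : ℕ → Set
Subsetᵇ n = Fin n → Bool

infix 4 _∈_ _∉_ _⊆_
infixr 7 _∩_
infixr 6 _∪_ _─_

_∈_ _∉_ : Fin n → Subsetᵇ n → Set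
i ∈ p = p i ≡ true
i ∉ p = p i ≡ false

_⊆_ : Subsetᵇ n → Subsetᵇ n → Set
p ⊆ q = ∀ i → i ∈ p → i ∈ q

full : Subsetᵇ n
full _ = true

∁ : Subsetᵇ n → Subsetᵇ n
∁ p i = not (p i)

_∩_ _∪_ _─_ : Subsetᵇ n → Subsetᵇ n → Subsetᵇ n
(p ∩ q) i = p i ∧ q i
(p ∪ q) i = p i ∨ q i
p ─ q = p ∩ ∁ q

⁅_⁆ : Fin n → Subsetᵇ n
⁅ i ⁆ j = does (j ≟ i)

_⁻¹_ : (Fin m → Fin n) → Subsetᵇ n → Subsetᵇ m
(f ⁻¹ p) i = p (f i)

∃ᵇ : Subsetᵇ n → Bool
∃ᵇ p = does (any? λ i → p i Bool.≟ true)

∈-or-∉ : ∀ (p : Subsetᵇ n) x → x ∈ p ⊎ x ∉ p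
∈-or-∉ p x with p x
... | true  = inj₁ refl
... | false = inj₂ refl

∉⇒¬∈ : ∀ (p : Subsetᵇ n) {x} → x ∉ p → ¬ x ∈ p
∉⇒¬∈ p x∉p x∈p with () ← trans (sym x∈p) x∉p

x∈p∩q⁺ : ∀ (p q : Subsetᵇ n) {x} → x ∈ p → x ∈ q → x ∈ p ∩ q
x∈p∩q⁺ p q x∈p x∈q rewrite x∈p = x∈q

x∈p∩q⁻ˡ : ∀ (p q : Subsetᵇ n) {x} → x ∈ p ∩ q → x ∈ p
x∈p∩q⁻ˡ p q {x} = Bool.∧-conicalˡ (p x) (q x)

x∈p∩q⁻ʳ : ∀ (p q : Subsetᵇ n) {x} → x ∈ p ∩ q → x ∈ q
x∈p∩q⁻ʳ p q {x} = Bool.∧-conicalʳ (p x) (q x)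

x∉p⇒x∉p∩q : ∀ (p q : Subsetᵇ n) {x} → x ∉ p → x ∉ p ∩ q
x∉p⇒x∉p∩q p q x∉p rewrite x∉p = refl

x∉q⇒x∉p∩q : ∀ (p q : Subsetᵇ n) {x} → x ∉ q → x ∉ p ∩ q
x∉q⇒x∉p∩q p q {x} x∉q rewrite x∉q = Bool.∧-zeroʳ (p x)

x∈p∪q⁺ˡ : ∀ (p q : Subsetᵇ n) {x} → x ∈ p → x ∈ p ∪ q
x∈p∪q⁺ˡ p q x∈p rewrite x∈p = refl

x∈p∪q⁺ʳ : ∀ (p q : Subsetᵇ n) {x} → x ∈ q → x ∈ p ∪ q
x∈p∪q⁺ʳ p q {x} x∈q rewrite x∈q = Bool.∨-zeroʳ (p x)

x∈p∪q⁻ : ∀ (p q : Subsetᵇ n) {x} → x ∈ p ∪ q → x ∈ p ⊎ x ∈ q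
x∈p∪q⁻ p q {x} x∈p∪q with p x
... | true  = inj₁ refl
... | false = inj₂ x∈p∪q

x∉p∪q⁻ : ∀ (p q : Subsetᵇ n) {x} → x ∉ p ∪ q → x ∉ p × x ∉ q
x∉p∪q⁻ p q {x} x∉p∪q with p x
... | false = refl , x∉p∪q

x∈p⇒x∉∁p : ∀ (p : Subsetᵇ n) {x} → x ∈ p → x ∉ ∁ p
x∈p⇒x∉∁p p x∈p rewrite x∈p = refl

x∉p⇒x∈∁p : ∀ (p : Subsetᵇ n) {x} → x ∉ p → x ∈ ∁ p
x∉p⇒x∈∁p p x∉p rewrite x∉p = refl

x∈p─q⁺ : ∀ (p q : Subsetᵇ n) {x} → x ∈ p → x ∉ q → x ∈ p ─ q
x∈p─q⁺ p q x∈p x∉q rewrite x∈p | x∉q = refl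

x∈p─q⁻ : ∀ (p q : Subsetᵇ n) {x} → x ∈ p ─ q → x ∉ q
x∈p─q⁻ p q {x} x∈p─q with q x | x∈p∩q⁻ʳ p (∁ q) x∈p─q
... | false | _ = refl

x∈q⇒x∉p─q : ∀ (p q : Subsetᵇ n) {x} → x ∈ q → x ∉ p ─ q
x∈q⇒x∉p─q p q {x} x∈q rewrite x∈q = Bool.∧-zeroʳ (p x)

x∉p─q⇒x∈q : ∀ (p q : Subsetᵇ n) {x} → x ∈ p → x ∉ p ─ q → x ∈ q
x∉p─q⇒x∈q p q {x} x∈p x∉p─q rewrite x∈p with q x
... | true = refl

x∈⁅x⁆ : ∀ (x : Fin n) → x ∈ ⁅ x ⁆
x∈⁅x⁆ x = dec-true (x ≟ x) refl

x∈⁅y⁆⇒x≡y : ∀ {x y : Fin n} → x ∈ ⁅ y ⁆ → x ≡ y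
x∈⁅y⁆⇒x≡y {x = x} {y} = does⇒ (x ≟ y)

∃ᵇ-intro : ∀ (p : Subsetᵇ n) x → x ∈ p → ∃ᵇ p ≡ true
∃ᵇ-intro p x x∈p = dec-true (any? _) (x , x∈p)

∃ᵇ-elim : ∀ (p : Subsetᵇ n) → ∃ᵇ p ≡ true → ∃ λ x → x ∈ p
∃ᵇ-elim p = does⇒ (any? λ i → p i Bool.≟ true)

≤-from-positive : ∀ {a b} → (0 < a → a ≤ b) → a ≤ b
≤-from-positive {zero}  _ = z≤n
≤-from-positive {suc a} f = f z<s

sum-mono-≤ : ∀ (f g : Fin n → ℕ) → (∀ i → f i ≤ g i) → sum f ≤ sum g
sum-mono-≤ {zero}  f g f≤g = z≤n
sum-mono-≤ {suc n} f g f≤g = +-mono-≤ (f≤g zero) (sum-mono-≤ (f ∘ suc) (g ∘ suc) (f≤g ∘ suc))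

sum-mono-< : ∀ (f g : Fin n → ℕ) → (∀ i → f i ≤ g i) → ∀ j → f j < g j → sum f < sum g
sum-mono-< {suc n} f g f≤g zero    fj<gj = +-mono-<-≤ fj<gj (sum-mono-≤ (f ∘ suc) (g ∘ suc) (f≤g ∘ suc))
sum-mono-< {suc n} f g f≤g (suc j) fj<gj = +-mono-≤-< (f≤g zero) (sum-mono-< (f ∘ suc) (g ∘ suc) (f≤g ∘ suc) j fj<gj)

sum-positive : ∀ (f : Fin n → ℕ) → 0 < sum f → ∃ λ i → 0 < f i
sum-positive {suc n} f 0<sum with f zero in f0≡
... | suc _ = zero , subst (0 <_) (sym f0≡) z<s
... | zero with sum-positive (f ∘ suc) 0<sum
...   | i , 0<fi = suc i , 0<fi

_↾_ : (Fin n → ℕ) → Subsetᵇ n → Fin n → ℕ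
(c ↾ p) i = if p i then c i else 0

∑∈-syntax : Subsetᵇ n → (Fin n → ℕ) → ℕ
∑∈-syntax p c = sum (c ↾ p)

syntax ∑∈-syntax p (λ i → x) = ∑[ i ∈ p ] x

𝟙 : Subsetᵇ n → Fin n → ℕ
𝟙 p = (λ _ → 1) ↾ p

count : Subsetᵇ n → ℕ
count p = sum (𝟙 p)

↾-mono : ∀ (c : Fin n → ℕ) {p q : Subsetᵇ n} i → (i ∈ p → i ∈ q) → (c ↾ p) i ≤ (c ↾ q) i
↾-mono c {p} i i∈p⇒i∈q with p i
... | true  rewrite i∈p⇒i∈q refl = ≤-refl
... | false = z≤n

↾-∈ : ∀ (c : Fin n → ℕ) p {i} → i ∈ p → (c ↾ p) i ≡ c i
↾-∈ c p i∈p rewrite i∈p = refl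

↾-∉ : ∀ (c : Fin n → ℕ) p {i} → i ∉ p → (c ↾ p) i ≡ 0
↾-∉ c p i∉p rewrite i∉p = refl

module _ {p q : Subsetᵇ n} {c : Fin n → ℕ} where

  ∑-cong : (∀ i → p i ≡ q i) → ∑[ i ∈ p ] c i ≡ ∑[ i ∈ q ] c i
  ∑-cong p≗q = sum-cong-≗ λ i → cong (if_then c i else 0) (p≗q i)

  ∑-split : ∑[ i ∈ p ] c i ≡ ∑[ i ∈ p ∩ q ] c i + ∑[ i ∈ p ─ q ] c i
  ∑-split = trans (sum-cong-≗ split) (∑-distrib-+ (c ↾ (p ∩ q)) (c ↾ (p ─ q)))
    where
    split : ∀ i → (c ↾ p) i ≡ (c ↾ (p ∩ q)) i + (c ↾ (p ─ q)) i
    split i with p i | q i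
    ... | true  | true  = sym (+-identityʳ (c i))
    ... | true  | false = refl
    ... | false | _     = refl

  ∑-∪ : ∑[ i ∈ p ∪ q ] c i ≡ ∑[ i ∈ p ─ q ] c i + ∑[ i ∈ q ] c i
  ∑-∪ = trans (sum-cong-≗ split) (∑-distrib-+ (c ↾ (p ─ q)) (c ↾ q))
    where
    split : ∀ i → (c ↾ (p ∪ q)) i ≡ (c ↾ (p ─ q)) i + (c ↾ q) i
    split i with p i | q i
    ... | true  | true  = refl
    ... | true  | false = sym (+-identityʳ (c i))
    ... | false | true  = refl
    ... | false | false = refl

  ∑-mono-⊆ : p ⊆ q → ∑[ i ∈ p ] c i ≤ ∑[ i ∈ q ] c i
  ∑-mono-⊆ p⊆q = sum-mono-≤ (c ↾ p) (c ↾ q) λ i → ↾-mono c {p} {q} i (p⊆q i)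

  ∑-mono-⊂ : p ⊆ q → ∀ j → j ∉ p → j ∈ q → 0 < c j → ∑[ i ∈ p ] c i < ∑[ i ∈ q ] c i
  ∑-mono-⊂ p⊆q j j∉p j∈q 0<cj = sum-mono-< (c ↾ p) (c ↾ q) (λ i → ↾-mono c {p} {q} i (p⊆q i)) j strict
    where
    strict : (c ↾ p) j < (c ↾ q) j
    strict rewrite j∉p | j∈q = 0<cj

module _ {p : Subsetᵇ n} {c : Fin n → ℕ} where

  ∑-positive : 0 < ∑[ i ∈ p ] c i → ∃ λ i → i ∈ p × 0 < c i
  ∑-positive 0<∑ with sum-positive (c ↾ p) 0<∑
  ... | i , 0<term with p i in i∈p
  ...   | true = i , i∈p , 0<term

  ∑-none : (∀ i → i ∈ p → ⊥) → ∑[ i ∈ p ] c i ≡ 0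
  ∑-none ∉p = n≤0⇒n≡0 (≤-trans (∑-mono-⊆ (λ i i∈p → ⊥-elim (∉p i i∈p))) (≤-reflexive (sum-replicate-zero n)))

  ∑-↾ : ∀ q → ∑[ i ∈ p ] (c ↾ q) i ≡ ∑[ i ∈ p ∩ q ] c i
  ∑-↾ q = sum-cong-≗ λ i → restrict i (p i)
    where
    restrict : ∀ i b → (if b then (c ↾ q) i else 0) ≡ (if b ∧ q i then c i else 0)
    restrict i true  = refl
    restrict i false = refl

  ∑-∸𝟙 : ∀ q → ∑[ i ∈ p ] c i ≤ count q + ∑[ i ∈ p ] (c i ∸ 𝟙 q i)
  ∑-∸𝟙 q = ≤-trans (sum-mono-≤ (c ↾ p) _ termwise) (≤-reflexive (∑-distrib-+ (𝟙 q) (c′ ↾ p)))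
    where
    c′ : Fin n → ℕ
    c′ i = c i ∸ 𝟙 q i
    termwise : ∀ i → (c ↾ p) i ≤ 𝟙 q i + (c′ ↾ p) i
    termwise i with p i
    ... | true  = m≤n+m∸n (c i) (𝟙 q i)
    ... | false = z≤n

count-positive : ∀ (p : Subsetᵇ n) → 0 < count p → ∃ λ i → i ∈ p
count-positive p 0<|p| with ∑-positive {p = p} 0<|p|
... | i , i∈p , _ = i , i∈p

∑-const : ∀ (p : Subsetᵇ n) k → ∑[ i ∈ p ] k ≡ k * count p
∑-const p k = trans (sum-cong-≗ termwise) (sym (*-distribˡ-sum k (𝟙 p)))
  where
  termwise : ∀ i → ((λ _ → k) ↾ p) i ≡ k * 𝟙 p i
  termwise i with p i
  ... | true  = sym (*-identityʳ k)
  ... | false = sym (*-zeroʳ k)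

count-⁅⁆ : ∀ (x : Fin n) → count ⁅ x ⁆ ≡ 1
count-⁅⁆ {suc n} zero    = cong suc (sum-replicate-zero n)
count-⁅⁆ {suc n} (suc x) = count-⁅⁆ x

count-full : ∀ {n} → count {n} full ≡ n
count-full {zero}  = refl
count-full {suc n} = cong suc (count-full {n})

count-fibre-injective : ∀ {k} (f : Fin k → ℕ) → Injective _≡_ _≡_ f →
                        ∀ a → count (λ i → does (f i ℕ.≟ a)) ≤ 1
count-fibre-injective f f-inj a with any? (λ i → f i ℕ.≟ a)
... | yes (i , fi≡a) = ≤-trans (∑-mono-⊆ {q = ⁅ i ⁆} fibre⊆⁅i⁆) (≤-reflexive (count-⁅⁆ i))
  where
  fibre⊆⁅i⁆ : (λ j → does (f j ℕ.≟ a)) ⊆ ⁅ i ⁆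
  fibre⊆⁅i⁆ j fj≡a = dec-true (j ≟ i) (f-inj (trans (does⇒ (f j ℕ.≟ a) fj≡a) (sym fi≡a)))
... | no ∄i = ≤-trans (≤-reflexive (∑-none {p = λ j → does (f j ℕ.≟ a)} empty)) z≤n
  where
  empty : ∀ j → j ∈ (λ j → does (f j ℕ.≟ a)) → ⊥
  empty j fj≡a = ∄i (j , does⇒ (f j ℕ.≟ a) fj≡a)

-- Hall's theorem with capacities

module CapacitatedHall {m n : ℕ} (A : Fin m → Subsetᵇ n) where

  containing : Fin n → Subsetᵇ m
  containing v e = A e v

  N : Subsetᵇ m → Subsetᵇ n
  N F v = ∃ᵇ (F ∩ containing v)

  ∈N⁺ : ∀ F {e v} → e ∈ F → v ∈ A e → v ∈ N F
  ∈N⁺ F {e} {v} e∈F v∈e = ∃ᵇ-intro (F ∩ containing v) e (x∈p∩q⁺ F (containing v) e∈F v∈e)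

  ∈N⁻ : ∀ F {v} → v ∈ N F → ∃ λ e → e ∈ F × v ∈ A e
  ∈N⁻ F {v} v∈NF with ∃ᵇ-elim (F ∩ containing v) v∈NF
  ... | e , e∈ = e , x∈p∩q⁻ˡ F (containing v) e∈ , x∈p∩q⁻ʳ F (containing v) e∈

  N-mono : ∀ {F E} → F ⊆ E → N F ⊆ N E
  N-mono {F} {E} F⊆E v v∈NF with ∈N⁻ F v∈NF
  ... | e , e∈F , v∈e = ∈N⁺ E (F⊆E e e∈F) v∈e

  N-∪ : ∀ {F E} → N (F ∪ E) ⊆ N F ∪ N E
  N-∪ {F} {E} v v∈N with ∈N⁻ (F ∪ E) v∈N
  ... | e , e∈F∪E , v∈e with x∈p∪q⁻ F E e∈F∪E
  ...   | inj₁ e∈F = x∈p∪q⁺ˡ (N F) (N E) (∈N⁺ F e∈F v∈e)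
  ...   | inj₂ e∈E = x∈p∪q⁺ʳ (N F) (N E) (∈N⁺ E e∈E v∈e)

  HallCondition : Subsetᵇ m → (Fin n → ℕ) → Set
  HallCondition D c = ∀ F → F ⊆ D → count F ≤ ∑[ v ∈ N F ] c v

  load : (Fin m → Fin n) → Subsetᵇ m → Fin n → ℕ
  load r D v = count (D ∩ r ⁻¹ ⁅ v ⁆)

  Representatives : Subsetᵇ m → (Fin n → ℕ) → Set
  Representatives D c = ∃ λ r → (∀ e → e ∈ D → r e ∈ A e) × (∀ v → load r D v ≤ c v)

  load-piecewise : ∀ D G r₁ r₂ v →
    load (λ e → if G e then r₁ e else r₂ e) D v ≡ load r₁ (D ∩ G) v + load r₂ (D ─ G) v
  load-piecewise D G r₁ r₂ v =
    trans (sum-cong-≗ termwise) (∑-distrib-+ (𝟙 ((D ∩ G) ∩ r₁ ⁻¹ ⁅ v ⁆)) (𝟙 ((D ─ G) ∩ r₂ ⁻¹ ⁅ v ⁆)))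
    where
    termwise : ∀ e → 𝟙 (D ∩ (λ e → if G e then r₁ e else r₂ e) ⁻¹ ⁅ v ⁆) e
                   ≡ 𝟙 ((D ∩ G) ∩ r₁ ⁻¹ ⁅ v ⁆) e + 𝟙 ((D ─ G) ∩ r₂ ⁻¹ ⁅ v ⁆) e
    termwise e with D e | G e
    ... | true  | true  = sym (+-identityʳ _)
    ... | true  | false = refl
    ... | false | _     = refl

  load-outside-N : ∀ D r → (∀ e → e ∈ D → r e ∈ A e) → ∀ {v} → v ∉ N D → load r D v ≡ 0
  load-outside-N D r r-rep {v} v∉ND = ∑-none {p = D ∩ r ⁻¹ ⁅ v ⁆} λ e e∈ →
    let e∈D = x∈p∩q⁻ˡ D (r ⁻¹ ⁅ v ⁆) e∈
        re≡v = x∈⁅y⁆⇒x≡y (x∈p∩q⁻ʳ D (r ⁻¹ ⁅ v ⁆) e∈)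
    in ∉⇒¬∈ (N D) v∉ND (∈N⁺ D e∈D (subst (_∈ A e) re≡v (r-rep e e∈D)))

  load-constant : ∀ D e₀ v u → load (λ _ → v) (D ∩ ⁅ e₀ ⁆) u ≤ 𝟙 ⁅ v ⁆ u
  load-constant D e₀ v u with u ≟ v
  ... | yes refl = begin
    load (λ _ → v) (D ∩ ⁅ e₀ ⁆) v  ≤⟨ ∑-mono-⊆ {q = ⁅ e₀ ⁆} ⊆⁅e₀⁆ ⟩
    count ⁅ e₀ ⁆                   ≡⟨ count-⁅⁆ e₀ ⟩
    1                              ∎
    where
    open ≤-Reasoning
    ⊆⁅e₀⁆ : (D ∩ ⁅ e₀ ⁆) ∩ (λ _ → ⁅ v ⁆ v) ⊆ ⁅ e₀ ⁆
    ⊆⁅e₀⁆ e e∈ = x∈p∩q⁻ʳ D ⁅ e₀ ⁆ (x∈p∩q⁻ˡ (D ∩ ⁅ e₀ ⁆) (λ _ → ⁅ v ⁆ v) e∈)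
  ... | no u≢v = ≤-reflexive (∑-none {p = (D ∩ ⁅ e₀ ⁆) ∩ (λ _ → ⁅ u ⁆ v)} λ e e∈ →
    u≢v (sym (x∈⁅y⁆⇒x≡y (x∈p∩q⁻ʳ (D ∩ ⁅ e₀ ⁆) (λ _ → ⁅ u ⁆ v) e∈))))

  -- Subfamilies are indexed by a Data.Fin.Subset G so that critical? can search them with
  -- anySubset?.
  Critical : Subsetᵇ m → (Fin n → ℕ) → Subset m → Set
  Critical D c G = 0 < count E × count E < count D × ∑[ v ∈ N E ] c v ≤ count E
    where E = D ∩ lookup G

  critical? : ∀ D c → Dec (∃ (Critical D c))
  critical? D c = anySubset? λ G → (0 <? _) ×-dec (_ <? _) ×-dec (_ ≤? _)

  surplus : ∀ {D c} → ¬ ∃ (Critical D c) → ∀ F → F ⊆ D → 0 < count F → count F < count D →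
            count F < ∑[ v ∈ N F ] c v
  surplus {D} {c} ¬crit F F⊆D 0<|F| |F|<|D| = ≰⇒> λ ∑NF≤|F| →
    ¬crit (tabulate F , subst (0 <_) (sym |E|≡|F|) 0<|F|
                      , subst (_< count D) (sym |E|≡|F|) |F|<|D|
                      , ≤-trans (∑-mono-⊆ (N-mono E⊆F)) (≤-trans ∑NF≤|F| (≤-reflexive (sym |E|≡|F|))))
    where
    E = D ∩ lookup (tabulate F)
    E≗F : ∀ e → E e ≡ F e
    E≗F e rewrite lookup∘tabulate F e with F e in e∈?F
    ... | true  = trans (Bool.∧-identityʳ (D e)) (F⊆D e e∈?F)
    ... | false = Bool.∧-zeroʳ (D e)
    E⊆F : E ⊆ F
    E⊆F e e∈E = trans (sym (E≗F e)) e∈E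
    |E|≡|F| : count E ≡ count F
    |E|≡|F| = ∑-cong E≗F

  RepresentativesBelow : Subsetᵇ m → Set
  RepresentativesBelow D = ∀ D′ c → count D′ < count D → HallCondition D′ c → Representatives D′ c

  -- v₀ is only a placeholder representative for the edges outside D.
  representatives-∅ : ∀ {D c} → Fin n → (∀ e → ¬ e ∈ D) → Representatives D c
  representatives-∅ {D} v₀ D-empty = (λ _ → v₀) , (λ e e∈D → ⊥-elim (D-empty e e∈D)) ,
    λ v → ≤-trans (≤-reflexive (∑-none {p = D ∩ (λ _ → v₀) ⁻¹ ⁅ v ⁆} λ e e∈ → D-empty e (x∈p∩q⁻ˡ D _ e∈))) z≤n

  -- A critical E exhausts the capacities on N E: E is served inside N E by induction, and D ─ E
  -- by the capacities left outside N E, which still satisfy Hall's condition.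
  representatives-critical : ∀ {D c} → RepresentativesBelow D → HallCondition D c →
                             ∀ G → Critical D c G → Representatives D c
  representatives-critical {D} {c} IH hall-D G (0<|E| , |E|<|D| , ∑NE≤|E|) = r , r-rep , r-load
    where
    G′ = lookup G
    E = D ∩ G′
    D₂ = D ─ G′
    c₂ = c ↾ ∁ (N E)

    hall-E : HallCondition E c
    hall-E F F⊆E = hall-D F λ e e∈F → x∈p∩q⁻ˡ D G′ {e} (F⊆E e e∈F)

    hall-D₂ : HallCondition D₂ c₂
    hall-D₂ F F⊆D₂ = +-cancelʳ-≤ (count E) (count F) (∑[ v ∈ N F ] c₂ v) (begin
      count F + count E                          ≤⟨ +-monoˡ-≤ (count E) (∑-mono-⊆ {p = F} {q = F ─ E} F⊆F─E) ⟩
      count (F ─ E) + count E                    ≡⟨ ∑-∪ {p = F} {q = E} ⟨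
      count (F ∪ E)                              ≤⟨ hall-D (F ∪ E) F∪E⊆D ⟩
      ∑[ v ∈ N (F ∪ E) ] c v                     ≤⟨ ∑-mono-⊆ {p = N (F ∪ E)} {q = N F ∪ N E} N-∪ ⟩
      ∑[ v ∈ N F ∪ N E ] c v                     ≡⟨ ∑-∪ {p = N F} {q = N E} ⟩
      ∑[ v ∈ N F ─ N E ] c v + ∑[ v ∈ N E ] c v  ≤⟨ +-monoʳ-≤ (∑[ v ∈ N F ─ N E ] c v) ∑NE≤|E| ⟩
      ∑[ v ∈ N F ─ N E ] c v + count E           ≡⟨ cong (_+ count E) (∑-↾ {p = N F} {c = c} (∁ (N E))) ⟨
      ∑[ v ∈ N F ] c₂ v + count E                ∎)
      where
      open ≤-Reasoning
      F⊆F─E : F ⊆ F ─ E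
      F⊆F─E e e∈F = x∈p─q⁺ F E e∈F (x∉q⇒x∉p∩q D G′ (x∈p─q⁻ D G′ (F⊆D₂ e e∈F)))
      F∪E⊆D : F ∪ E ⊆ D
      F∪E⊆D e e∈F∪E with x∈p∪q⁻ F E e∈F∪E
      ... | inj₁ e∈F = x∈p∩q⁻ˡ D (∁ G′) (F⊆D₂ e e∈F)
      ... | inj₂ e∈E = x∈p∩q⁻ˡ D G′ e∈E

    |D₂|<|D| : count D₂ < count D
    |D₂|<|D| = subst (count D₂ <_) (sym (∑-split {p = D} {q = G′})) (m<n+m (count D₂) 0<|E|)

    R₁ = IH E c |E|<|D| hall-E
    R₂ = IH D₂ c₂ |D₂|<|D| hall-D₂
    r₁ = proj₁ R₁
    r₂ = proj₁ R₂

    r : Fin m → Fin n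
    r e = if G′ e then r₁ e else r₂ e

    r-rep : ∀ e → e ∈ D → r e ∈ A e
    r-rep e e∈D with G′ e in e∈?G′
    ... | true  = proj₁ (proj₂ R₁) e (x∈p∩q⁺ D G′ e∈D e∈?G′)
    ... | false = proj₁ (proj₂ R₂) e (x∈p─q⁺ D G′ e∈D e∈?G′)

    r-load : ∀ v → load r D v ≤ c v
    r-load v = ≤-trans (≤-reflexive (load-piecewise D G′ r₁ r₂ v)) bound
      where
      bound : load r₁ E v + load r₂ D₂ v ≤ c v
      bound with N E v in v∈?NE
      ... | true = begin
        load r₁ E v + load r₂ D₂ v  ≤⟨ +-mono-≤ (proj₂ (proj₂ R₁) v) (proj₂ (proj₂ R₂) v) ⟩
        c v + c₂ v                  ≡⟨ cong (c v +_) (↾-∉ c (∁ (N E)) (x∈p⇒x∉∁p (N E) v∈?NE)) ⟩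
        c v + 0                     ≡⟨ +-identityʳ (c v) ⟩
        c v                         ∎
        where open ≤-Reasoning
      ... | false = begin
        load r₁ E v + load r₂ D₂ v  ≡⟨ cong (_+ load r₂ D₂ v) (load-outside-N E r₁ (proj₁ (proj₂ R₁)) v∈?NE) ⟩
        load r₂ D₂ v                ≤⟨ proj₂ (proj₂ R₂) v ⟩
        c₂ v                        ≡⟨ ↾-∈ c (∁ (N E)) (x∉p⇒x∈∁p (N E) v∈?NE) ⟩
        c v                         ∎
        where open ≤-Reasoning

  -- Without a critical subfamily every nonempty proper subfamily has capacity to spare, so one
  -- unit of capacity at a vertex of e₀ can be spent on e₀.
  representatives-noncritical : ∀ {D c} → RepresentativesBelow D → HallCondition D c → ¬ ∃ (Critical D c) →
                             ∀ e₀ → e₀ ∈ D → Representatives D c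
  representatives-noncritical {D} {c} IH hall-D ¬crit e₀ e₀∈D = r , r-rep , r-load
    where
    ⁅e₀⁆⊆D : ⁅ e₀ ⁆ ⊆ D
    ⁅e₀⁆⊆D e e≡e₀ = subst (_∈ D) (sym (x∈⁅y⁆⇒x≡y e≡e₀)) e₀∈D

    0<∑ : 0 < ∑[ u ∈ N ⁅ e₀ ⁆ ] c u
    0<∑ = subst (_≤ ∑[ u ∈ N ⁅ e₀ ⁆ ] c u) (count-⁅⁆ e₀) (hall-D ⁅ e₀ ⁆ ⁅e₀⁆⊆D)

    spare-vertex : ∃ λ v → v ∈ A e₀ × 0 < c v
    spare-vertex with ∑-positive {p = N ⁅ e₀ ⁆} {c} 0<∑
    ... | v , v∈N , 0<cv with ∈N⁻ ⁅ e₀ ⁆ v∈N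
    ...   | e , e≡e₀ , v∈e = v , subst (λ e → v ∈ A e) (x∈⁅y⁆⇒x≡y e≡e₀) v∈e , 0<cv

    v = proj₁ spare-vertex
    D′ = D ─ ⁅ e₀ ⁆

    c′ : Fin n → ℕ
    c′ u = c u ∸ 𝟙 ⁅ v ⁆ u

    |D′|<|D| : count D′ < count D
    |D′|<|D| = ∑-mono-⊂ {p = D′} {q = D} (λ e → x∈p∩q⁻ˡ D (∁ ⁅ e₀ ⁆)) e₀ (x∈q⇒x∉p─q D ⁅ e₀ ⁆ (x∈⁅x⁆ e₀)) e₀∈D z<s

    hall-D′ : HallCondition D′ c′
    hall-D′ F F⊆D′ = ≤-from-positive λ 0<|F| → s≤s⁻¹ (begin-strict
      count F                            <⟨ surplus ¬crit F F⊆D 0<|F| |F|<|D| ⟩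
      ∑[ u ∈ N F ] c u                   ≤⟨ ∑-∸𝟙 {p = N F} {c = c} ⁅ v ⁆ ⟩
      count ⁅ v ⁆ + ∑[ u ∈ N F ] c′ u    ≡⟨ cong (_+ ∑[ u ∈ N F ] c′ u) (count-⁅⁆ v) ⟩
      suc (∑[ u ∈ N F ] c′ u)            ∎)
      where
      open ≤-Reasoning
      F⊆D : F ⊆ D
      F⊆D e e∈F = x∈p∩q⁻ˡ D (∁ ⁅ e₀ ⁆) (F⊆D′ e e∈F)
      |F|<|D| = ≤-<-trans (∑-mono-⊆ {p = F} {q = D′} F⊆D′) |D′|<|D|

    R′ = IH D′ c′ |D′|<|D| hall-D′
    r′ = proj₁ R′

    r : Fin m → Fin n
    r e = if ⁅ e₀ ⁆ e then v else r′ e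

    r-rep : ∀ e → e ∈ D → r e ∈ A e
    r-rep e e∈D with ⁅ e₀ ⁆ e in e∈?⁅e₀⁆
    ... | true  = subst (λ e → v ∈ A e) (sym (x∈⁅y⁆⇒x≡y e∈?⁅e₀⁆)) (proj₁ (proj₂ spare-vertex))
    ... | false = proj₁ (proj₂ R′) e (x∈p─q⁺ D ⁅ e₀ ⁆ e∈D e∈?⁅e₀⁆)

    𝟙⁅v⁆≤c : ∀ u → 𝟙 ⁅ v ⁆ u ≤ c u
    𝟙⁅v⁆≤c u with u ≟ v
    ... | yes refl = proj₂ (proj₂ spare-vertex)
    ... | no _     = z≤n

    r-load : ∀ u → load r D u ≤ c u
    r-load u = begin
      load r D u                                        ≡⟨ load-piecewise D ⁅ e₀ ⁆ (λ _ → v) r′ u ⟩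
      load (λ _ → v) (D ∩ ⁅ e₀ ⁆) u + load r′ D′ u      ≤⟨ +-mono-≤ (load-constant D e₀ v u) (proj₂ (proj₂ R′) u) ⟩
      𝟙 ⁅ v ⁆ u + (c u ∸ 𝟙 ⁅ v ⁆ u)                     ≡⟨ m+[n∸m]≡n (𝟙⁅v⁆≤c u) ⟩
      c u                                               ∎
      where open ≤-Reasoning

  hall-step : Fin n → ∀ D c → RepresentativesBelow D → HallCondition D c → Representatives D c
  hall-step v₀ D c IH hall-D with any? (λ e → D e Bool.≟ true)
  ... | no D-empty = representatives-∅ v₀ λ e e∈D → D-empty (e , e∈D)
  ... | yes (e₀ , e₀∈D) with critical? D c
  ...   | yes (G , crit) = representatives-critical IH hall-D G crit
  ...   | no ¬crit       = representatives-noncritical IH hall-D ¬crit e₀ e₀∈D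

  hall-acc : Fin n → ∀ D c → Acc _<_ (count D) → HallCondition D c → Representatives D c
  hall-acc v₀ D c (acc below) = hall-step v₀ D c λ D′ c′ |D′|<|D| → hall-acc v₀ D′ c′ (below |D′|<|D|)

  hall : Fin n → ∀ D c → HallCondition D c → Representatives D c
  hall v₀ D c = hall-acc v₀ D c (<-wellFounded (count D))

-- Kernels of digraphs and the kernel method

module Digraph {m n : ℕ} (tail head : Fin m → Fin n) where

  Independent : Subsetᵇ n → Set
  Independent K = ∀ a → tail a ∈ K → head a ∈ K → ⊥

  Absorbing : Subsetᵇ n → Subsetᵇ n → Set
  Absorbing U K = ∀ v → v ∈ U → v ∉ K → ∃ λ a → tail a ≡ v × head a ∈ K

  IsKernel : Subsetᵇ n → Subsetᵇ n → Set
  IsKernel U K = K ⊆ U × Independent K × Absorbing U K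

  KernelPerfect : Set
  KernelPerfect = ∀ U → ∃ (IsKernel U)

  out-arcs : Subsetᵇ n → Fin n → Subsetᵇ m
  out-arcs W v = head ⁻¹ W ∩ tail ⁻¹ ⁅ v ⁆

  outdeg : Subsetᵇ n → Fin n → ℕ
  outdeg W v = count (out-arcs W v)

  out-arcs-mono : ∀ {W′ W} → W′ ⊆ W → ∀ v → out-arcs W′ v ⊆ out-arcs W v
  out-arcs-mono {W′} {W} W′⊆W v a a∈ =
    x∈p∩q⁺ (head ⁻¹ W) (tail ⁻¹ ⁅ v ⁆) (W′⊆W (head a) (x∈p∩q⁻ˡ (head ⁻¹ W′) (tail ⁻¹ ⁅ v ⁆) a∈))
                                        (x∈p∩q⁻ʳ (head ⁻¹ W′) (tail ⁻¹ ⁅ v ⁆) a∈)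

  outdeg-mono : ∀ {W′ W} → W′ ⊆ W → ∀ v → outdeg W′ v ≤ outdeg W v
  outdeg-mono {W′} {W} W′⊆W v = ∑-mono-⊆ {p = out-arcs W′ v} {q = out-arcs W v} (out-arcs-mono W′⊆W v)

  outdeg-mono-< : ∀ {W′ W} → W′ ⊆ W → ∀ a → head a ∉ W′ → head a ∈ W → outdeg W′ (tail a) < outdeg W (tail a)
  outdeg-mono-< {W′} {W} W′⊆W a head∉W′ head∈W =
    ∑-mono-⊂ {p = out-arcs W′ (tail a)} {q = out-arcs W (tail a)} (out-arcs-mono W′⊆W (tail a)) a
      (x∉p⇒x∉p∩q (head ⁻¹ W′) (tail ⁻¹ ⁅ tail a ⁆) head∉W′)
      (x∈p∩q⁺ (head ⁻¹ W) (tail ⁻¹ ⁅ tail a ⁆) head∈W (x∈⁅x⁆ (tail a))) z<s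

  in-neighbours : Fin n → Subsetᵇ n
  in-neighbours s v = ∃ᵇ (tail ⁻¹ ⁅ v ⁆ ∩ head ⁻¹ ⁅ s ⁆)

  module Bipartite (side : Fin n → Bool) (bipartite : ∀ a → side (tail a) ≢ side (head a)) where

    IsSink : Subsetᵇ n → Fin n → Set
    IsSink U v = v ∈ U × side v ≡ true × ¬ ∃ λ a → tail a ≡ v × head a ∈ U

    out-arc-into? : ∀ U v → Dec (∃ λ a → tail a ≡ v × head a ∈ U)
    out-arc-into? U v = any? λ a → (tail a ≟ v) ×-dec (U (head a) Bool.≟ true)

    sink? : ∀ U → Dec (∃ (IsSink U))
    sink? U = any? λ v → (U v Bool.≟ true) ×-dec (side v Bool.≟ true) ×-dec ¬? (out-arc-into? U v)

    kernel-without-sink : ∀ U → ¬ ∃ (IsSink U) → IsKernel U (U ─ side)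
    kernel-without-sink U ¬sink = (λ v → x∈p∩q⁻ˡ U (∁ side)) , independent , absorbing
      where
      independent : Independent (U ─ side)
      independent a tail∈ head∈ = bipartite a (trans (x∈p─q⁻ U side tail∈) (sym (x∈p─q⁻ U side head∈)))
      absorbing : Absorbing U (U ─ side)
      absorbing v v∈U v∉K with out-arc-into? U v
      ... | no ∄a = ⊥-elim (¬sink (v , v∈U , x∉p─q⇒x∈q U side v∈U v∉K , ∄a))
      ... | yes (a , refl , head∈U) = a , refl , x∈p─q⁺ U side head∈U head-side
        where
        head-side : side (head a) ≡ false
        head-side = trans (Bool.¬-not (bipartite a ∘ sym)) (cong not (x∉p─q⇒x∈q U side v∈U v∉K))

    module _ (U : Subsetᵇ n) (s : Fin n) (sink : IsSink U s) where

      s∈U = proj₁ sink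
      no-arc-from-s = proj₂ (proj₂ sink)

      U′ : Subsetᵇ n
      U′ = (U ─ ⁅ s ⁆) ─ in-neighbours s

      U′⊆U : U′ ⊆ U
      U′⊆U v v∈U′ = x∈p∩q⁻ˡ U (∁ ⁅ s ⁆) (x∈p∩q⁻ˡ (U ─ ⁅ s ⁆) (∁ (in-neighbours s)) v∈U′)

      |U′|<|U| : count U′ < count U
      |U′|<|U| = ∑-mono-⊂ {p = U′} {q = U} U′⊆U s
        (x∉p⇒x∉p∩q (U ─ ⁅ s ⁆) (∁ (in-neighbours s)) (x∈q⇒x∉p─q U ⁅ s ⁆ (x∈⁅x⁆ s))) s∈U z<s

      kernel-with-sink : ∀ {K′} → IsKernel U′ K′ → IsKernel U (K′ ∪ ⁅ s ⁆)
      kernel-with-sink {K′} (K′⊆U′ , independent′ , absorbing′) = K⊆U , independent , absorbing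
        where
        K⊆U : K′ ∪ ⁅ s ⁆ ⊆ U
        K⊆U v v∈K with x∈p∪q⁻ K′ ⁅ s ⁆ v∈K
        ... | inj₁ v∈K′ = U′⊆U v (K′⊆U′ v v∈K′)
        ... | inj₂ v≡s  = subst (_∈ U) (sym (x∈⁅y⁆⇒x≡y v≡s)) s∈U

        independent : Independent (K′ ∪ ⁅ s ⁆)
        independent a tail∈K head∈K with x∈p∪q⁻ K′ ⁅ s ⁆ tail∈K | x∈p∪q⁻ K′ ⁅ s ⁆ head∈K
        ... | inj₂ tail≡s | _ = no-arc-from-s (a , x∈⁅y⁆⇒x≡y tail≡s , K⊆U (head a) head∈K)
        ... | inj₁ tail∈K′ | inj₁ head∈K′ = independent′ a tail∈K′ head∈K′
        ... | inj₁ tail∈K′ | inj₂ head≡s =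
          ∉⇒¬∈ (in-neighbours s) (x∈p─q⁻ (U ─ ⁅ s ⁆) (in-neighbours s) (K′⊆U′ (tail a) tail∈K′))
            (∃ᵇ-intro (tail ⁻¹ ⁅ tail a ⁆ ∩ head ⁻¹ ⁅ s ⁆) a
               (x∈p∩q⁺ (tail ⁻¹ ⁅ tail a ⁆) (head ⁻¹ ⁅ s ⁆) (x∈⁅x⁆ (tail a)) head≡s))

        absorbing : Absorbing U (K′ ∪ ⁅ s ⁆)
        absorbing v v∈U v∉K with x∉p∪q⁻ K′ ⁅ s ⁆ v∉K | in-neighbours s v in v∈?in-neighbours
        ... | _ , _ | true with ∃ᵇ-elim (tail ⁻¹ ⁅ v ⁆ ∩ head ⁻¹ ⁅ s ⁆) v∈?in-neighbours
        ...   | a , a∈ = a , x∈⁅y⁆⇒x≡y (x∈p∩q⁻ˡ (tail ⁻¹ ⁅ v ⁆) (head ⁻¹ ⁅ s ⁆) a∈)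
                           , x∈p∪q⁺ʳ K′ ⁅ s ⁆ (x∈p∩q⁻ʳ (tail ⁻¹ ⁅ v ⁆) (head ⁻¹ ⁅ s ⁆) a∈)
        absorbing v v∈U v∉K | v∉K′ , v∉⁅s⁆ | false
          with absorbing′ v (x∈p─q⁺ (U ─ ⁅ s ⁆) (in-neighbours s) (x∈p─q⁺ U ⁅ s ⁆ v∈U v∉⁅s⁆) v∈?in-neighbours) v∉K′
        ... | a , tail≡v , head∈K′ = a , tail≡v , x∈p∪q⁺ˡ K′ ⁅ s ⁆ head∈K′

    -- A sink s on the true side joins a kernel of U without s and its in-neighbours; if there
    -- is no such sink, the false side of U is already a kernel.
    kernel-acc : ∀ U → Acc _<_ (count U) → ∃ (IsKernel U)
    kernel-acc U (acc below) with sink? U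
    ... | no ¬sink = U ─ side , kernel-without-sink U ¬sink
    ... | yes (s , sink) with kernel-acc (U′ U s sink) (below (|U′|<|U| U s sink))
    ...   | K′ , K′-kernel = K′ ∪ ⁅ s ⁆ , kernel-with-sink U s sink K′-kernel

    bipartite-kernel-perfect : KernelPerfect
    bipartite-kernel-perfect U = kernel-acc U (<-wellFounded (count U))

  module ListColouring (kernel-perfect : KernelPerfect) {k : ℕ} (list : Fin n → Fin k → ℕ)
                       (list-injective : ∀ v → Injective _≡_ _≡_ (list v)) where

    μ : Subsetᵇ n → (Fin n → Subsetᵇ k) → ℕ
    μ W S = ∑[ v ∈ W ] count (S v)

    Room : Subsetᵇ n → (Fin n → Subsetᵇ k) → Set
    Room W S = ∀ v → v ∈ W → outdeg W v < count (S v)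

    Colouring : Subsetᵇ n → (Fin n → Subsetᵇ k) → Set
    Colouring W S = ∃ λ (c : Fin n → ℕ) → (∀ v → v ∈ W → ∃ λ i → i ∈ S v × list v i ≡ c v)
                          × (∀ a → tail a ∈ W → head a ∈ W → c (tail a) ≢ c (head a))

    ColouringBelow : Subsetᵇ n → (Fin n → Subsetᵇ k) → Set
    ColouringBelow W S = ∀ W′ S′ → μ W′ S′ < μ W S → Room W′ S′ → Colouring W′ S′

    -- Kernel method: some colour α occurs in a list; a kernel K of the vertices that can still
    -- take α is coloured α, and the rest is coloured by induction on W ─ K with α deleted from
    -- all lists. Every vertex of W ─ K losing α has an arc into K, so its outdegree drops too.
    module Step (W : Subsetᵇ n) (S : Fin n → Subsetᵇ k) (IH : ColouringBelow W S) (room : Room W S)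
                (v₀ : Fin n) (v₀∈W : v₀ ∈ W) where

      available-position : ∃ λ i → i ∈ S v₀
      available-position = count-positive (S v₀) (≤-<-trans z≤n (room v₀ v₀∈W))

      i₀ = proj₁ available-position
      α = list v₀ i₀

      holds-α : Fin n → Subsetᵇ k
      holds-α v i = does (list v i ℕ.≟ α)

      has-α : Subsetᵇ n
      has-α v = ∃ᵇ (S v ∩ holds-α v)

      U : Subsetᵇ n
      U = W ∩ has-α

      K = proj₁ (kernel-perfect U)
      K⊆U = proj₁ (proj₂ (kernel-perfect U))

      W′ : Subsetᵇ n
      W′ = W ─ K

      S′ : Fin n → Subsetᵇ k
      S′ v = S v ─ holds-α v

      μ′<μ : μ W′ S′ < μ W S
      μ′<μ = sum-mono-< _ _ termwise v₀ strict
        where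
        termwise : ∀ v → ((count ∘ S′) ↾ W′) v ≤ ((count ∘ S) ↾ W) v
        termwise v with W v | K v
        ... | true  | false = ∑-mono-⊆ {p = S′ v} {q = S v} λ i → x∈p∩q⁻ˡ (S v) (∁ (holds-α v))
        ... | true  | true  = z≤n
        ... | false | _     = z≤n
        strict : ((count ∘ S′) ↾ W′) v₀ < ((count ∘ S) ↾ W) v₀
        strict with ∈-or-∉ K v₀
        ... | inj₁ v₀∈K = subst₂ _<_
          (sym (↾-∉ (count ∘ S′) W′ (x∉q⇒x∉p∩q W (∁ K) (x∈p⇒x∉∁p K v₀∈K))))
          (sym (↾-∈ (count ∘ S) W v₀∈W))
          (≤-<-trans z≤n (room v₀ v₀∈W))
        ... | inj₂ v₀∉K = subst₂ _<_
          (sym (↾-∈ (count ∘ S′) W′ (x∈p─q⁺ W K v₀∈W v₀∉K)))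
          (sym (↾-∈ (count ∘ S) W v₀∈W))
          (∑-mono-⊂ {p = S′ v₀} {q = S v₀} (λ i → x∈p∩q⁻ˡ (S v₀) (∁ (holds-α v₀))) i₀
             (x∈q⇒x∉p─q (S v₀) (holds-α v₀) (dec-true (α ℕ.≟ α) refl)) (proj₂ available-position) z<s)

      |S|≡ : ∀ v → count (S v) ≡ count (S v ∩ holds-α v) + count (S′ v)
      |S|≡ v = ∑-split {p = S v} {q = holds-α v}

      W′⊆W : W′ ⊆ W
      W′⊆W v = x∈p∩q⁻ˡ W (∁ K)

      room′ : Room W′ S′
      room′ v v∈W′ with ∈-or-∉ U v
      ... | inj₁ v∈U with proj₂ (proj₂ (proj₂ (kernel-perfect U))) v v∈U (x∈p─q⁻ W K v∈W′)
      ...   | a , refl , head∈K = s≤s⁻¹ (begin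
        suc (suc (outdeg W′ v))                 ≤⟨ s≤s (outdeg-mono-< W′⊆W a head∉W′ head∈W) ⟩
        suc (outdeg W v)                        ≤⟨ room v (W′⊆W v v∈W′) ⟩
        count (S v)                             ≡⟨ |S|≡ v ⟩
        count (S v ∩ holds-α v) + count (S′ v)  ≤⟨ +-monoˡ-≤ (count (S′ v)) |S∩holds|≤1 ⟩
        suc (count (S′ v))                      ∎)
        where
        open ≤-Reasoning
        head∉W′ = x∈q⇒x∉p─q W K head∈K
        head∈W = x∈p∩q⁻ˡ W has-α (K⊆U (head a) head∈K)
        |S∩holds|≤1 : count (S v ∩ holds-α v) ≤ 1
        |S∩holds|≤1 = ≤-trans (∑-mono-⊆ {p = S v ∩ holds-α v} {q = holds-α v} (λ i → x∈p∩q⁻ʳ (S v) (holds-α v)))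
                              (count-fibre-injective (list v) (list-injective v) α)
      room′ v v∈W′ | inj₂ v∉U = begin-strict
        outdeg W′ v                              ≤⟨ outdeg-mono W′⊆W v ⟩
        outdeg W v                               <⟨ room v (W′⊆W v v∈W′) ⟩
        count (S v)                              ≡⟨ |S|≡ v ⟩
        count (S v ∩ holds-α v) + count (S′ v)   ≡⟨ cong (_+ count (S′ v)) no-α ⟩
        count (S′ v)                             ∎
        where
        open ≤-Reasoning
        no-α : count (S v ∩ holds-α v) ≡ 0
        no-α = ∑-none {p = S v ∩ holds-α v} λ i i∈ →
          ∉⇒¬∈ U v∉U (x∈p∩q⁺ W has-α (W′⊆W v v∈W′) (∃ᵇ-intro (S v ∩ holds-α v) i i∈))

      colouring′ = IH W′ S′ μ′<μ room′
      c′ = proj₁ colouring′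
      c′-lists = proj₁ (proj₂ colouring′)

      c′≢α : ∀ v → v ∈ W′ → c′ v ≢ α
      c′≢α v v∈W′ c′v≡α with c′-lists v v∈W′
      ... | i , i∈S′ , list≡c′ =
        ∉⇒¬∈ (holds-α v) (x∈p─q⁻ (S v) (holds-α v) i∈S′) (dec-true (list v i ℕ.≟ α) (trans list≡c′ c′v≡α))

      c : Fin n → ℕ
      c v = if K v then α else c′ v

      c-lists : ∀ v → v ∈ W → ∃ λ i → i ∈ S v × list v i ≡ c v
      c-lists v v∈W with K v in v∈?K
      ... | true with ∃ᵇ-elim (S v ∩ holds-α v) (x∈p∩q⁻ʳ W has-α (K⊆U v v∈?K))
      ...   | i , i∈ = i , x∈p∩q⁻ˡ (S v) (holds-α v) i∈ , does⇒ (list v i ℕ.≟ α) (x∈p∩q⁻ʳ (S v) (holds-α v) i∈)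
      c-lists v v∈W | false with c′-lists v (x∈p─q⁺ W K v∈W v∈?K)
      ... | i , i∈S′ , list≡c′ = i , x∈p∩q⁻ˡ (S v) (∁ (holds-α v)) i∈S′ , list≡c′

      c-proper : ∀ a → tail a ∈ W → head a ∈ W → c (tail a) ≢ c (head a)
      c-proper a tail∈W head∈W with K (tail a) in tail∈?K | K (head a) in head∈?K
      ... | true  | true  = λ _ → proj₁ (proj₂ (proj₂ (kernel-perfect U))) a tail∈?K head∈?K
      ... | true  | false = c′≢α (head a) (x∈p─q⁺ W K head∈W head∈?K) ∘ sym
      ... | false | true  = c′≢α (tail a) (x∈p─q⁺ W K tail∈W tail∈?K)
      ... | false | false = proj₂ (proj₂ colouring′) a (x∈p─q⁺ W K tail∈W tail∈?K) (x∈p─q⁺ W K head∈W head∈?K)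

      colouring : Colouring W S
      colouring = c , c-lists , c-proper

    colouring-step : ∀ W S → ColouringBelow W S → Room W S → Colouring W S
    colouring-step W S IH room with any? (λ v → W v Bool.≟ true)
    ... | yes (v₀ , v₀∈W) = Step.colouring W S IH room v₀ v₀∈W
    ... | no W-empty = (λ _ → 0) , (λ v v∈W → ⊥-elim (W-empty (v , v∈W)))
                                 , (λ a tail∈W _ → ⊥-elim (W-empty (tail a , tail∈W)))

    colouring-acc : ∀ W S → Acc _<_ (μ W S) → Room W S → Colouring W S
    colouring-acc W S (acc below) = colouring-step W S λ W′ S′ μ′<μ → colouring-acc W′ S′ (below μ′<μ)

    list-colouring : ∀ W S → Room W S → Colouring W S
    list-colouring W S = colouring-acc W S (<-wellFounded (μ W S))

-- Hypergraphs

∣p∣≡count : ∀ {n} (p : Subset n) → ∣ p ∣ ≡ count (lookup p)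
∣p∣≡count []          = refl
∣p∣≡count (true ∷ p)  = cong suc (∣p∣≡count p)
∣p∣≡count (false ∷ p) = ∣p∣≡count p

x∈⋃⁻ : ∀ {n} {x : Fin n} (ps : List (Subset n)) → x S.∈ ⋃ ps → ∃ λ p → p ∈ₗ ps × x S.∈ p
x∈⋃⁻ []       x∈⋃ = ⊥-elim (S.∉⊥ x∈⋃)
x∈⋃⁻ (p ∷ ps) x∈⋃ with S.x∈p∪q⁻ p (⋃ ps) x∈⋃
... | inj₁ x∈p  = p , here refl , x∈p
... | inj₂ x∈⋃′ with x∈⋃⁻ ps x∈⋃′
...   | q , q∈ps , x∈q = q , there q∈ps , x∈q

module _ {n m} (H : Hypergraph n m) where

  incidence : Fin m → Subsetᵇ n
  incidence e = lookup (edge H e)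

  open CapacitatedHall incidence

  ∈unionOf⁻ : ∀ E′ {v} → v S.∈ unionOf H E′ → ∃ λ e → lookup E′ e ≡ true × v S.∈ edge H e
  ∈unionOf⁻ E′ v∈⋃ with x∈⋃⁻ (map (edge H) (filterᵇ (lookup E′) (allFin m))) v∈⋃
  ... | p , p∈ , v∈p with ∈-map⁻ (edge H) p∈
  ...   | e , e∈ , refl =
    e , Equivalence.to Bool.T-≡ (proj₂ (∈-filter⁻ (T? ∘ lookup E′) {xs = allFin m} e∈)) , v∈p

  unionOf⊆N : ∀ F → lookup (unionOf H (tabulate F)) ⊆ N F
  unionOf⊆N F v v∈⋃ with ∈unionOf⁻ (tabulate F) (lookup⇒[]= v _ v∈⋃)
  ... | e , e∈ , v∈e = ∈N⁺ F (trans (sym (lookup∘tabulate F e)) e∈) ([]=⇒lookup v∈e)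

  LBound⇒HallCondition : ∀ {k} → LBound H k → HallCondition full (λ _ → k)
  LBound⇒HallCondition {k} bound F _ = ≤-from-positive λ 0<|F| → begin
    count F                              ≡⟨ |tabulate-F| ⟨
    ∣ tabulate F ∣                       ≤⟨ bound (tabulate F) (nonempty 0<|F|) ⟩
    k * ∣ unionOf H (tabulate F) ∣       ≡⟨ cong (k *_) (∣p∣≡count (unionOf H (tabulate F))) ⟩
    k * count (lookup (unionOf H (tabulate F)))
                                         ≤⟨ *-monoʳ-≤ k (∑-mono-⊆ {q = N F} (unionOf⊆N F)) ⟩
    k * count (N F)                      ≡⟨ ∑-const (N F) k ⟨
    ∑[ v ∈ N F ] k                       ∎
    where
    open ≤-Reasoning
    |tabulate-F| : ∣ tabulate F ∣ ≡ count F
    |tabulate-F| = trans (∣p∣≡count (tabulate F)) (∑-cong {p = lookup (tabulate F)} {q = F} (lookup∘tabulate F))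
    nonempty : 0 < count F → S.Nonempty (tabulate F)
    nonempty 0<|F| with count-positive F 0<|F|
    ... | e , e∈F = e , lookup⇒[]= e (tabulate F) (trans (lookup∘tabulate F e) e∈F)

bichromatic-partner : ∀ {n m k} (H : Hypergraph n m) (f : Fin n → Fin k) → Proper H f →
                      ∀ e {x} → x S.∈ edge H e → ∃ λ y → y S.∈ edge H e × f x ≢ f y
bichromatic-partner H f f-proper e {x} x∈e with f-proper e
... | u , v , u∈e , v∈e , fu≢fv with f u ≟ f x
... | yes fu≡fx = v , v∈e , λ fx≡fv → fu≢fv (trans fu≡fx fx≡fv)
... | no  fu≢fx = u , u∈e , λ fx≡fu → fu≢fx (sym fx≡fu)

is-zero-injective : ∀ (x y : Fin 2) → does (x ≟ zero) ≡ does (y ≟ zero) → x ≡ y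
is-zero-injective zero       zero       _ = refl
is-zero-injective (suc zero) (suc zero) _ = refl

module _ {n m k : ℕ} (H : Hypergraph n m) (f : Fin n → Fin 2) (f-proper : Proper H f) where

  open CapacitatedHall (incidence H)

  choosable-from-representatives : ∀ r → (∀ e → r e S.∈ edge H e) → (∀ v → load r full v ≤ k) →
                                   Choosable H (suc k)
  choosable-from-representatives r r∈e load≤k lists = c , c-lists , c-proper
    where
    partner : ∀ e → ∃ λ y → y S.∈ edge H e × f (r e) ≢ f y
    partner e = bichromatic-partner H f f-proper e (r∈e e)

    w : Fin m → Fin n
    w e = proj₁ (partner e)

    open Digraph r w
    open Bipartite (λ v → does (f v ≟ zero)) (λ e → proj₂ (proj₂ (partner e)) ∘ is-zero-injective _ _)
    open ListColouring bipartite-kernel-perfect (proj₁ ∘ lists) (proj₂ ∘ lists)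

    -- The outdegree of v is the number of edges it represents.
    room : Room full (λ _ → full)
    room v _ = s≤s (≤-trans (load≤k v) (≤-reflexive (sym count-full)))

    colouring = list-colouring full (λ _ → full) room
    c = proj₁ colouring

    c-lists : ∀ v → c v ∈L lists v
    c-lists v with proj₁ (proj₂ colouring) v refl
    ... | i , _ , list≡c = i , list≡c

    c-proper : Proper H c
    c-proper e = r e , w e , r∈e e , proj₁ (proj₂ (partner e)) , proj₂ (proj₂ colouring) e refl refl

  LBound⇒Choosable : Fin n → LBound H k → Choosable H (suc k)
  LBound⇒Choosable v₀ bound with hall v₀ full (λ _ → k) (LBound⇒HallCondition H bound)
  ... | r , r∈e , load≤k =
    choosable-from-representatives r (λ e → lookup⇒[]= (r e) (edge H e) (r∈e e refl)) load≤k

-- Only L(H) ≤ k is used, not the minimality of k; m ≥ 1 provides the placeholder vertex that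
-- Hall's theorem needs.
theorem6 : ∀ {n m} (H : Hypergraph n m) → m ≥ 1 → TwoColorable H →
    ∀ k → IsCeilL H k → ChAtMost H (suc k)
theorem6 {m = suc m} H _ (f , f-proper) k (bound , _) =
  suc k , ≤-refl , LBound⇒Choosable H f f-proper (proj₁ (f-proper zero)) bound
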